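{- Let $\Gamma=(S,R)$ be a finite simple graph, $xy\in R$, and $\widehat\Gamma$ obtained by inserting a new vertex $z$ on $xy$. If $O$ is a $\widehat W$-orbit of $\widehat V^*$ with $O\neq\{0\}$, then $\delta_u(O)\neq\{0\}$ for each $u\in\{x,y\}$.
   Context: $\widehat S=S\cup\{z\}$, $\widehat R=(R\setminus\{xy\})\cup\{xz,yz\}$. $V$ (resp. $\widehat V$) is the $\mathbb F_2$-vector space with basis $\{\alpha_s\mid s\in S\}$ (resp. $\{\alpha_s\mid s\in\widehat S\}$); $V^*$, $\widehat V^*$ are the duals with dual bases $\{f_s\}$, $\{h_s\}$. $\widehat W$ is the Coxeter group generated by $\widehat S$ with relations $s^2=1$, $(st)^2=1$ if $st\notin\widehat R$, $(st)^3=1$ if $st\in\widehat R$; it acts on $\widehat V^*$ via the representation $\widehat\kappa$ with $\widehat\kappa(s)h=h+h(\alpha_s)\sum_{t:\,st\in\widehat R}h_t$. For $u\in\{x,y\}$, $\delta_u:\widehat V^*\to V^*$ is the linear map with $\delta_u(h_z)=f_u$ and $\delta_u(h_s)=f_s$ for $s\in S$. -}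

module Defs where

open import Data.Nat using (ℕ; suc)
open import Data.Fin using (Fin; zero; suc; _≟_)
open import Data.Bool using (Bool; true; false; _∧_; _∨_; _xor_; not)
open import Data.List using (List; foldr)
open import Relation.Nullary.Decidable using (⌊_⌋)
open import Relation.Binary.PropositionalEquality using (_≡_)

record SimpleGraph (n : ℕ) : Set where
  field
    adj   : Fin n → Fin n → Bool
    sym   : ∀ s t → adj s t ≡ adj t s
    irrefl : ∀ s → adj s s ≡ false
open SimpleGraph public

_==_ : ∀ {n} → Fin n → Fin n → Bool
a == b = ⌊ a ≟ b ⌋

isEdgeXY : ∀ {n} → Fin n → Fin n → Fin n → Fin n → Bool
isEdgeXY x y a b = ((a == x) ∧ (b == y)) ∨ ((a == y) ∧ (b == x))

-- Subdivided graph Γ̂ on Ŝ = S ∪ {z} = Fin (suc n):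
-- the new vertex z is  zero , an old vertex s ∈ S is  suc s .
-- R̂ = (R ∖ {xy}) ∪ {xz , yz}.
adjHat : ∀ {n} → SimpleGraph n → Fin n → Fin n → Fin (suc n) → Fin (suc n) → Bool
adjHat Γ x y zero    zero    = false
adjHat Γ x y zero    (suc b) = (b == x) ∨ (b == y)
adjHat Γ x y (suc a) zero    = (a == x) ∨ (a == y)
adjHat Γ x y (suc a) (suc b) = adj Γ a b ∧ not (isEdgeXY x y a b)

-- Dual spaces over 𝔽₂ = Bool (xor = addition, ∧ = multiplication):
-- a covector h is given by its coordinates h(α_s) in the dual basis.
V* : ℕ → Set
V* n = Fin n → Bool

-- κ̂(s) h = h + h(α_s) Σ_{t : st ∈ R̂} h_t, coordinatewise at t.
κ̂ : ∀ {n} → SimpleGraph n → Fin n → Fin n → Fin (suc n) → V* (suc n) → V* (suc n)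
κ̂ Γ x y s h t = h t xor (h s ∧ adjHat Γ x y s t)

actWord : ∀ {n} → SimpleGraph n → Fin n → Fin n → List (Fin (suc n)) → V* (suc n) → V* (suc n)
actWord Γ x y w h = foldr (κ̂ Γ x y) h w

-- δ_u : V̂* → V*, δ_u(h_z) = f_u, δ_u(h_s) = f_s (s ∈ S); coordinatewise:
-- (δ_u h)(α_s) = h(α_s) + h(α_z)·[s = u].
δ : ∀ {n} → Fin n → V* (suc n) → V* n
δ u h s = h (suc s) xor (h zero ∧ (s == u))

-- Let g be a nonzero element of the orbit and let v be the endpoint of xy other
-- than u, so that v is a neighbour of z in Γ̂ and (δ_u g)(α_v) = g(α_v).  If
-- g(α_z) = 0 then δ_u g and g have the same old coordinates, so δ_u g ≠ 0.
-- If g(α_z) = 1, then either g(α_v) = 1, or κ̂(z) flips the v-coordinate to 1;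
-- in both cases δ_u does not vanish on g or on κ̂(z) g, both in the orbit.
module Submission where

open import Defs hiding (sym)
open import Data.Nat using (suc)
open import Data.Fin using (Fin; zero; suc; _≟_)
open import Data.Bool using (true; false; _∨_)
open import Data.Bool.Properties using (∨-zeroʳ; ∧-zeroʳ; xor-identityʳ)
open import Data.List using (List; []; _∷_; _++_)
open import Data.List.Properties using (foldr-++)
open import Data.Sum using (_⊎_; inj₁; inj₂)
open import Data.Product using (∃; ∃-syntax; _×_; _,_)
open import Relation.Binary.PropositionalEquality using (_≡_; refl; sym; trans; cong)
open import Relation.Nullary using (¬_; yes; no; contradiction)

==-refl : ∀ {n} (a : Fin n) → (a == a) ≡ true
==-refl a with a ≟ a
... | yes _   = refl
... | no a≢a = contradiction refl a≢a

≢⇒==-false : ∀ {n} {a b : Fin n} → ¬ a ≡ b → (a == b) ≡ false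
≢⇒==-false {a = a} {b} a≢b with a ≟ b
... | yes a≡b = contradiction a≡b a≢b
... | no _    = refl

adj⇒≢ : ∀ {n} (Γ : SimpleGraph n) {x y : Fin n} → adj Γ x y ≡ true → ¬ x ≡ y
adj⇒≢ Γ {x} axy refl with () ← trans (sym axy) (irrefl Γ x)

actWord-++ : ∀ {n} (Γ : SimpleGraph n) (x y : Fin n) (w w′ : List (Fin (suc n)))
  (h : V* (suc n)) → actWord Γ x y (w′ ++ w) h ≡ actWord Γ x y w′ (actWord Γ x y w h)
actWord-++ Γ x y w w′ h = foldr-++ (κ̂ Γ x y) h w′ w

δ-of-z-free : ∀ {n} (u s : Fin n) (h : V* (suc n)) → h zero ≡ false → δ u h s ≡ h (suc s)
δ-of-z-free u s h hz rewrite hz = xor-identityʳ (h (suc s))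

δ-away-from-u : ∀ {n} {u s : Fin n} (h : V* (suc n)) → (s == u) ≡ false → δ u h s ≡ h (suc s)
δ-away-from-u {s = s} h s≠u rewrite s≠u | ∧-zeroʳ (h zero) = xor-identityʳ (h (suc s))

κ̂z-flips-neighbour : ∀ {n} (Γ : SimpleGraph n) (x y v : Fin n) (h : V* (suc n)) →
  h zero ≡ true → adjHat Γ x y zero (suc v) ≡ true → h (suc v) ≡ false →
  κ̂ Γ x y zero h (suc v) ≡ true
κ̂z-flips-neighbour Γ x y v h hz zv hv rewrite hz | zv | hv = refl

other-endpoint : ∀ {n} (Γ : SimpleGraph n) (x y u : Fin n) → ¬ x ≡ y → u ≡ x ⊎ u ≡ y →
  ∃[ v ] (v == u) ≡ false × adjHat Γ x y zero (suc v) ≡ true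
other-endpoint Γ x y u x≢y (inj₁ refl) =
  y , ≢⇒==-false (λ y≡x → x≢y (sym y≡x)) , trans (cong ((y == x) ∨_) (==-refl y)) (∨-zeroʳ _)
other-endpoint Γ x y u x≢y (inj₂ refl) =
  x , ≢⇒==-false x≢y , cong (_∨ (x == y)) (==-refl x)

δ-nonzero-within-one-step : ∀ {n} (Γ : SimpleGraph n) (x y u v : Fin n) →
  (v == u) ≡ false → adjHat Γ x y zero (suc v) ≡ true →
  (g : V* (suc n)) (t : Fin (suc n)) → g t ≡ true →
  ∃[ w ] ∃[ s ] δ u (actWord Γ x y w g) s ≡ true
δ-nonzero-within-one-step Γ x y u v v≠u zv g t gt with g zero in gz
δ-nonzero-within-one-step Γ x y u v v≠u zv g zero    gt | false with () ← trans (sym gz) gt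
δ-nonzero-within-one-step Γ x y u v v≠u zv g (suc s) gt | false =
  [] , s , trans (δ-of-z-free u s g gz) gt
δ-nonzero-within-one-step Γ x y u v v≠u zv g t gt | true with g (suc v) in gv
... | true  = [] , v , trans (δ-away-from-u g v≠u) gv
... | false = zero ∷ [] , v ,
  trans (δ-away-from-u (κ̂ Γ x y zero g) v≠u) (κ̂z-flips-neighbour Γ x y v g gz zv gv)

lemma4p2 : ∀ {n} (Γ : SimpleGraph n) (x y : Fin n) → adj Γ x y ≡ true →
    (h : V* (suc n)) →
    (∃[ w ] ∃[ t ] actWord Γ x y w h t ≡ true) →
    ∀ (u : Fin n) → (u ≡ x ⊎ u ≡ y) →
    ∃[ w ] ∃[ s ] δ u (actWord Γ x y w h) s ≡ true
lemma4p2 Γ x y axy h (w , t , gt) u u∈xy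
  with v , v≠u , zv ← other-endpoint Γ x y u (adj⇒≢ Γ axy) u∈xy
  with w′ , s , δs ← δ-nonzero-within-one-step Γ x y u v v≠u zv (actWord Γ x y w h) t gt
  = w′ ++ w , s , trans (cong (λ g → δ u g s) (actWord-++ Γ x y w w′ h)) δs
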